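{- Let $\Pi\subseteq S_3$ be nonempty and intersect exactly one of the sets $M_1,M_2,M_3$. Then for all $n\ge3$, $$\log_2(n-1)+1\le p_\Pi(n)\le 4\lceil\log_2 n\rceil.$$
   Context: Elements of $S_3$ are written as words $abc$. Let $M_1=\{213,312\}$, $M_2=\{123,321\}$ and $M_3=\{132,231\}$. An ordering of $[n]$ is a bijection $\phi:[n]\to[n]$. A ternary constraint is a triple $\mathbf x=(x_1,x_2,x_3)$ of distinct elements of $[n]$. $\mathrm{ord}(\phi,\mathbf x)$ is the word $abc$ with $\phi(x_a)<\phi(x_b)<\phi(x_c)$. For nonempty $\Pi$, $p_\Pi(n)$ is the minimum size of a set $\Phi$ of orderings of $[n]$ such that every constraint $\mathbf x$ has some $\phi\in\Phi$ with $\mathrm{ord}(\phi,\mathbf x)\in\Pi$. -}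

module Defs where

open import Data.Nat using (ℕ; _≤_; _*_; _∸_; _^_)
open import Data.Fin using (Fin; zero; suc; _<_)
open import Data.Fin.Permutation using (Permutation′; _⟨$⟩ʳ_)
open import Data.Bool using (Bool; true)
open import Data.List using (List; length)
open import Data.List.Membership.Propositional using (_∈_)
open import Data.Product using (Σ; ∃; _×_; _,_)
open import Relation.Binary.PropositionalEquality using (_≡_)
open import Function.Definitions using (Injective)

data S3 : Set where
  w123 w132 w213 w231 w312 w321 : S3

-- The letters of a word abc (letter 1,2,3 ↦ Fin 3 index 0,1,2).
letters : S3 → Fin 3 × Fin 3 × Fin 3
letters w123 = zero , suc zero , suc (suc zero)
letters w132 = zero , suc (suc zero) , suc zero
letters w213 = suc zero , zero , suc (suc zero)
letters w231 = suc zero , suc (suc zero) , zero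
letters w312 = suc (suc zero) , zero , suc zero
letters w321 = suc (suc zero) , suc zero , zero

SubS3 : Set
SubS3 = S3 → Bool

_∈Π_ : S3 → SubS3 → Set
w ∈Π Π = Π w ≡ true

-- M_1 = {213,312}, M_2 = {123,321}, M_3 = {132,231}
M : Fin 3 → S3 → Set
M zero w = (w ≡ w213) Data.Sum.⊎ (w ≡ w312)
  where import Data.Sum
M (suc zero) w = (w ≡ w123) Data.Sum.⊎ (w ≡ w321)
  where import Data.Sum
M (suc (suc zero)) w = (w ≡ w132) Data.Sum.⊎ (w ≡ w231)
  where import Data.Sum

Meets : SubS3 → Fin 3 → Set
Meets Π i = ∃ λ w → M i w × w ∈Π Π

NonEmpty : SubS3 → Set
NonEmpty Π = ∃ λ w → w ∈Π Π

MeetsExactlyOne : SubS3 → Set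
MeetsExactlyOne Π = ∃ λ i → Meets Π i × (∀ j → Meets Π j → j ≡ i)

Ordering : ℕ → Set
Ordering n = Permutation′ n

Constraint : ℕ → Set
Constraint n = Σ (Fin 3 → Fin n) (λ x → Injective _≡_ _≡_ x)

Ord≡ : ∀ {n} → Ordering n → Constraint n → S3 → Set
Ord≡ φ (x , _) w with letters w
... | a , b , c = ((φ ⟨$⟩ʳ x a) < (φ ⟨$⟩ʳ x b)) × ((φ ⟨$⟩ʳ x b) < (φ ⟨$⟩ʳ x c))

Covers : ∀ {n} → SubS3 → List (Ordering n) → Set
Covers {n} Π Φ = (x : Constraint n) → ∃ λ φ → φ ∈ Φ × ∃ λ w → w ∈Π Π × Ord≡ φ x w

module Submission where

-- Upper bound (only Π ≠ ∅ is used; fix w ∈ Π).  Label the elements by their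
-- L = ⌈log₂ n⌉ binary digits.  For each digit position j, letter β and direction,
-- the two-block ordering lists the elements whose j-th digit is β first and sorts
-- each block ascending or descending.  These 4L orderings sort every triple of
-- distinct elements, in particular the triple of any constraint read in the order
-- given by w.
--
-- Lower bound.  Π lies inside the unique M_i it meets, and the words of M_i have
-- the letter i in the middle; so covering the constraint with y at position i
-- forces an ordering putting y strictly between the other two elements.  Let y be
-- the first element of some φ ∈ Φ.  The other orderings Ψ then separate every pair
-- of elements ≠ y by their sides of y: this is a separating binary labelling of
-- n - 1 elements by words of length |Ψ|, whence n - 1 ≤ 2 ^ |Ψ|.

open import Defs
open import Data.Nat using (ℕ; zero; suc; _+_; _*_; _∸_; _^_; _≤_; _<_; _<ᵇ_; z≤n; s≤s; ⌈_/2⌉; ⌊_/2⌋)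
open import Data.Nat.Logarithm using (⌈log₂_⌉)
open import Data.Nat.Logarithm.Core using (⌈log2⌉)
open import Induction.WellFounded using (Acc; acc)
open import Data.Nat.Properties
  using (≤-reflexive; n≮0; <-asym; <ᵇ⇒<; <⇒<ᵇ; <-irrefl; <-trans; <-cmp; <-≤-trans; ≤-trans; m≤m+n; +-monoʳ-<; +-cancelˡ-≡; *-monoʳ-≤;
         ∸-monoʳ-<; ⌊n/2⌋+⌈n/2⌉≡n; ⌊n/2⌋≤⌈n/2⌉; +-monoˡ-≤; +-identityʳ; *-suc; 1+n≰n; module ≤-Reasoning)
open import Data.Bool using (Bool; true; false; if_then_else_)
open import Data.Fin as Fin using (Fin; zero; suc; toℕ; fromℕ<; punchIn; punchOut; opposite; inject≤; funToFin; finToFun; combine)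
open import Data.Fin.Properties
  using (toℕ-fromℕ<; toℕ-injective; toℕ<n; any?; _≟_; punchOut-injective; punchIn-injective; punchInᵢ≢i; injective⇒≤;
         opposite-prop; opposite-involutive;
         finToFun-funToFin; funToFin-finToFin; inject≤-injective; ¬∀⟶∃¬)
open import Data.Fin.Permutation using (permutation; _⟨$⟩ʳ_; _⟨$⟩ˡ_; inverseʳ)
open import Data.Fin.Subset using (Subset; ∣_∣) renaming (_∈_ to _∈ₛ_)
open import Data.Fin.Subset.Properties using (p⊂q⇒∣p∣<∣q∣; ∣⊤∣≡n; ∈⊤)
open import Data.Vec using (tabulate)
open import Data.Vec.Properties using (lookup∘tabulate; lookup⇒[]=; []=⇒lookup)
open import Data.List using (List; []; _∷_; length; concatMap; allFin; lookup)
open import Data.List.Properties using (length-tabulate)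
open import Data.List.Membership.Propositional using (_∈_; lose)
open import Data.List.Membership.Propositional.Properties using (∈-concatMap⁺; ∈-allFin)
open import Data.List.Relation.Unary.Any using (here; there; index)
open import Data.List.Relation.Unary.Any.Properties using (lookup-index)
open import Data.Sum using (_⊎_; inj₁; inj₂)
open import Function using (id; _∘′_)
open import Data.Product using (∃; _×_; _,_; proj₁; proj₂)
open import Data.Empty using (⊥-elim)
open import Function.Definitions using (Injective)
open import Relation.Nullary using (Dec; yes; no; does; ¬_)
open import Relation.Nullary.Decidable using (dec-true; dec-false)
open import Data.Bool.Properties using (T-≡)
open import Function.Bundles using (Equivalence)
open import Relation.Binary.PropositionalEquality
open import Relation.Binary.Definitions using (tri<; tri≈; tri>)

-- An injective endomap of Fin n is onto (pigeonhole): a missed value would let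
-- us squeeze Fin n injectively into Fin (n - 1).
injective⇒onto : ∀ {n} (f : Fin n → Fin n) → Injective _≡_ _≡_ f → ∀ y → ∃ λ x → f x ≡ y
injective⇒onto {zero} f inj ()
injective⇒onto {suc m} f inj y with any? (λ x → f x ≟ y)
... | yes hit = hit
... | no miss = ⊥-elim (1+n≰n (injective⇒≤ squeeze-injective))
  where
  missed : ∀ x → y ≢ f x
  missed x eq = miss (x , sym eq)
  squeeze : Fin (suc m) → Fin m
  squeeze x = punchOut (missed x)
  squeeze-injective : Injective _≡_ _≡_ squeeze
  squeeze-injective {x} {z} eq = inj (punchOut-injective (missed x) (missed z) eq)

injectionOrdering : ∀ {n} (f : Fin n → Fin n) → Injective _≡_ _≡_ f → Ordering n
injectionOrdering f inj = permutation f (λ y → proj₁ (onto y)) (λ y → proj₂ (onto y)) (λ x → inj (proj₂ (onto (f x))))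
  where
  onto : ∀ y → ∃ λ x → f x ≡ y
  onto = injective⇒onto f inj

below : ∀ {n} → (Fin n → ℕ) → Fin n → Subset n
below key x = tabulate (λ y → key y <ᵇ key x)

∈below⁺ : ∀ {n} (key : Fin n → ℕ) {x y} → key y < key x → y ∈ₛ below key x
∈below⁺ key {x} {y} lt = lookup⇒[]= y _ (trans (lookup∘tabulate _ y) (Equivalence.to T-≡ (<⇒<ᵇ lt)))

∈below⁻ : ∀ {n} (key : Fin n → ℕ) {x y} → y ∈ₛ below key x → key y < key x
∈below⁻ key {x} {y} y∈ =
  <ᵇ⇒< (key y) (key x) (Equivalence.from T-≡ (trans (sym (lookup∘tabulate _ y)) ([]=⇒lookup y∈)))

-- The rank of x: how many elements have a smaller key.  Ranks lie below n and
-- are strictly monotone in the key, because `below` grows strictly.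
rank : ∀ {n} → (Fin n → ℕ) → Fin n → ℕ
rank key x = ∣ below key x ∣

rank<n : ∀ {n} (key : Fin n → ℕ) x → rank key x < n
rank<n {n} key x = subst (rank key x <_) (∣⊤∣≡n n)
  (p⊂q⇒∣p∣<∣q∣ ((λ _ → ∈⊤) , x , ∈⊤ , λ x∈ → <-irrefl refl (∈below⁻ key x∈)))

rank-mono : ∀ {n} (key : Fin n → ℕ) {x z} → key x < key z → rank key x < rank key z
rank-mono key {x} {z} lt = p⊂q⇒∣p∣<∣q∣
  ( (λ y∈ → ∈below⁺ key (<-trans (∈below⁻ key y∈) lt))
  , x , ∈below⁺ key lt , λ x∈ → <-irrefl refl (∈below⁻ key x∈))

rankFin : ∀ {n} → (Fin n → ℕ) → Fin n → Fin n
rankFin key x = fromℕ< (rank<n key x)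

rankFin-mono : ∀ {n} (key : Fin n → ℕ) {x z} → key x < key z → rankFin key x Fin.< rankFin key z
rankFin-mono key {x} {z} lt =
  subst₂ _<_ (sym (toℕ-fromℕ< (rank<n key x))) (sym (toℕ-fromℕ< (rank<n key z))) (rank-mono key lt)

rankFin-injective : ∀ {n} (key : Fin n → ℕ) → Injective _≡_ _≡_ key → Injective _≡_ _≡_ (rankFin key)
rankFin-injective key key-inj {x} {z} eq with <-cmp (key x) (key z)
... | tri< lt _ _ = ⊥-elim (<-irrefl (cong toℕ eq) (rankFin-mono key lt))
... | tri≈ _ same _ = key-inj same
... | tri> _ _ gt = ⊥-elim (<-irrefl (cong toℕ (sym eq)) (rankFin-mono key gt))

-- Only monotonicity is
-- used afterwards, so the construction is kept abstract (this also keeps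
-- type checking from unfolding the ranking).
abstract
  keyOrdering : ∀ {n} (key : Fin n → ℕ) → Injective _≡_ _≡_ key → Ordering n
  keyOrdering key key-inj = injectionOrdering (rankFin key) (rankFin-injective key key-inj)

  keyOrdering-mono : ∀ {n} (key : Fin n → ℕ) (key-inj : Injective _≡_ _≡_ key) {x z} →
    key x < key z → keyOrdering key key-inj ⟨$⟩ʳ x Fin.< keyOrdering key key-inj ⟨$⟩ʳ z
  keyOrdering-mono key _ = rankFin-mono key

data Direction : Set where
  ascending descending : Direction

inner : ∀ {n} → Direction → Fin n → Fin n
inner ascending  x = x
inner descending x = opposite x

inner-injective : ∀ {n} d → Injective _≡_ _≡_ (inner {n} d)
inner-injective ascending  eq = eq
inner-injective descending {x} {z} eq =
  trans (sym (opposite-involutive x)) (trans (cong opposite eq) (opposite-involutive z))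

orient : ∀ {n} {a b : Fin n} → a ≢ b → ∃ λ d → inner d a Fin.< inner d b
orient {n} {a} {b} a≢b with <-cmp (toℕ a) (toℕ b)
... | tri< lt _ _ = ascending , lt
... | tri≈ _ same _ = ⊥-elim (a≢b (toℕ-injective same))
... | tri> _ _ gt = descending ,
  subst₂ _<_ (sym (opposite-prop a)) (sym (opposite-prop b)) (∸-monoʳ-< {m = n} (s≤s gt) (toℕ<n a))

blockKey : ∀ {n} → (Fin n → Bool) → Direction → Fin n → ℕ
blockKey {n} first d x = (if first x then 0 else n) + toℕ (inner d x)

blockKey-injective : ∀ {n} (first : Fin n → Bool) d → Injective _≡_ _≡_ (blockKey first d)
blockKey-injective {n} first d {x} {z} eq with first x | first z
... | true  | true  = inner-injective d (toℕ-injective eq)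
... | false | false = inner-injective d (toℕ-injective (+-cancelˡ-≡ n _ _ eq))
... | true  | false = ⊥-elim (<-irrefl eq (<-≤-trans (toℕ<n (inner d x)) (m≤m+n n _)))
... | false | true  = ⊥-elim (<-irrefl (sym eq) (<-≤-trans (toℕ<n (inner d z)) (m≤m+n n _)))

blockOrdering : ∀ {n} → (Fin n → Bool) → Direction → Ordering n
blockOrdering first d = keyOrdering (blockKey first d) (blockKey-injective first d)

blockOrdering-across : ∀ {n} (first : Fin n → Bool) d {x z} → first x ≡ true → first z ≡ false →
  blockOrdering first d ⟨$⟩ʳ x Fin.< blockOrdering first d ⟨$⟩ʳ z
blockOrdering-across {n} first d {x} {z} x-first z-second =
  keyOrdering-mono (blockKey first d) (blockKey-injective first d) x<z
  where
  x<z : blockKey first d x < blockKey first d z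
  x<z rewrite x-first | z-second = <-≤-trans (toℕ<n (inner d x)) (m≤m+n n _)

blockOrdering-within : ∀ {n} (first : Fin n → Bool) d {x z} → first x ≡ first z →
  inner d x Fin.< inner d z → blockOrdering first d ⟨$⟩ʳ x Fin.< blockOrdering first d ⟨$⟩ʳ z
blockOrdering-within {n} first d {x} {z} same lt =
  keyOrdering-mono (blockKey first d) (blockKey-injective first d) x<z
  where
  x<z : blockKey first d x < blockKey first d z
  x<z rewrite same = +-monoʳ-< (if first z then 0 else n) lt

Separating : ∀ {m k c} → (Fin m → Fin k → Fin c) → Set
Separating {m} label = ∀ {a b : Fin m} → a ≢ b → ∃ λ j → label a j ≢ label b j

funToFin-cong : ∀ {k c} {f g : Fin k → Fin c} → (∀ j → f j ≡ g j) → funToFin f ≡ funToFin g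
funToFin-cong {zero}  _  = refl
funToFin-cong {suc k} eq = cong₂ combine (eq zero) (funToFin-cong (λ j → eq (suc j)))

-- Counting bound: separating words of length k over c letters exist only if m ≤ c ^ k,
-- since reading the words as numbers in base c is then injective.
separating⇒≤ : ∀ {m k c} (label : Fin m → Fin k → Fin c) → Separating label → m ≤ c ^ k
separating⇒≤ {k = k} label separating = injective⇒≤ number-injective
  where
  number-injective : Injective _≡_ _≡_ (λ a → funToFin (label a))
  number-injective {a} {b} eq with a ≟ b
  ... | yes a≡b = a≡b
  ... | no a≢b = ⊥-elim (differ (begin
      label a j                         ≡⟨ finToFun-funToFin (label a) j ⟨
      finToFun (funToFin (label a)) j   ≡⟨ cong (λ i → finToFun i j) eq ⟩
      finToFun (funToFin (label b)) j   ≡⟨ finToFun-funToFin (label b) j ⟩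
      label b j                         ∎))
    where
    open ≡-Reasoning
    j : Fin k
    j = proj₁ (separating a≢b)
    differ : label a j ≢ label b j
    differ = proj₂ (separating a≢b)

digits : ∀ {m k c} → m ≤ c ^ k → Fin m → Fin k → Fin c
digits m≤c^k a = finToFun (inject≤ a m≤c^k)

digits-separating : ∀ {m k c} (m≤c^k : m ≤ c ^ k) → Separating (digits {m} {k} {c} m≤c^k)
digits-separating {m} {k} {c} m≤c^k {a} {b} a≢b =
  ¬∀⟶∃¬ k _ (λ j → digit a j ≟ digit b j) same-digits⇒same
  where
  open ≡-Reasoning
  digit : Fin m → Fin k → Fin c
  digit = digits m≤c^k
  same-digits⇒same : ¬ (∀ j → digit a j ≡ digit b j)
  same-digits⇒same same = a≢b (inject≤-injective m≤c^k m≤c^k a b (begin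
    inject≤ a m≤c^k         ≡⟨ funToFin-finToFin {k} {c} (inject≤ a m≤c^k) ⟨
    funToFin (digit a)      ≡⟨ funToFin-cong same ⟩
    funToFin (digit b)      ≡⟨ funToFin-finToFin {k} {c} (inject≤ b m≤c^k) ⟩
    inject≤ b m≤c^k         ∎))

-- n ≤ 2 ^ ⌈log₂ n⌉, by the recursion ⌈log₂ n⌉ = 1 + ⌈log₂ ⌈n/2⌉⌉ for n ≥ 2.
n≤2*⌈n/2⌉ : ∀ n → n ≤ 2 * ⌈ n /2⌉
n≤2*⌈n/2⌉ n = begin
  n                       ≡⟨ ⌊n/2⌋+⌈n/2⌉≡n n ⟨
  ⌊ n /2⌋ + ⌈ n /2⌉       ≤⟨ +-monoˡ-≤ ⌈ n /2⌉ (⌊n/2⌋≤⌈n/2⌉ n) ⟩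
  ⌈ n /2⌉ + ⌈ n /2⌉       ≡⟨ cong (⌈ n /2⌉ +_) (+-identityʳ ⌈ n /2⌉) ⟨
  2 * ⌈ n /2⌉             ∎
  where open ≤-Reasoning

≤2^⌈log2⌉ : ∀ n (rec : Acc _<_ n) → n ≤ 2 ^ ⌈log2⌉ n rec
≤2^⌈log2⌉ zero                _        = z≤n
≤2^⌈log2⌉ (suc zero)          _        = s≤s z≤n
≤2^⌈log2⌉ (suc (suc m)) (acc rec) =
  ≤-trans (n≤2*⌈n/2⌉ (suc (suc m))) (*-monoʳ-≤ 2 (≤2^⌈log2⌉ (suc ⌈ m /2⌉) _))

n≤2^⌈log₂n⌉ : ∀ n → n ≤ 2 ^ ⌈log₂ n ⌉
n≤2^⌈log₂n⌉ n = ≤2^⌈log2⌉ n _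

testOrdering : ∀ {n L} → (Fin n → Fin L → Fin 2) → Fin L → Fin 2 → Direction → Ordering n
testOrdering label j β = blockOrdering (λ x → does (label x j ≟ β))

testOrderingsAt : ∀ {n L} → (Fin n → Fin L → Fin 2) → Fin L → List (Ordering n)
testOrderingsAt label j =
  testOrdering label j zero ascending ∷ testOrdering label j zero descending ∷
  testOrdering label j (suc zero) ascending ∷ testOrdering label j (suc zero) descending ∷ []

testFamily : ∀ {n L} → (Fin n → Fin L → Fin 2) → List (Ordering n)
testFamily {L = L} label = concatMap (testOrderingsAt label) (allFin L)

testFamily-length : ∀ {n L} (label : Fin n → Fin L → Fin 2) → length (testFamily label) ≡ 4 * L
testFamily-length {L = L} label = trans (four-each (allFin L)) (cong (4 *_) (length-tabulate {n = L} id))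
  where
  four-each : ∀ js → length (concatMap (testOrderingsAt label) js) ≡ 4 * length js
  four-each []       = refl
  four-each (j ∷ js) = trans (cong (4 +_) (four-each js)) (sym (*-suc 4 (length js)))

testOrdering∈testFamily : ∀ {n L} (label : Fin n → Fin L → Fin 2) j β d →
  testOrdering label j β d ∈ testFamily label
testOrdering∈testFamily label j β d =
  ∈-concatMap⁺ (testOrderingsAt label) (lose (∈-allFin j) (∈testOrderingsAt β d))
  where
  ∈testOrderingsAt : ∀ β d → testOrdering label j β d ∈ testOrderingsAt label j
  ∈testOrderingsAt zero       ascending  = here refl
  ∈testOrderingsAt zero       descending = there (here refl)
  ∈testOrderingsAt (suc zero) ascending  = there (there (here refl))
  ∈testOrderingsAt (suc zero) descending = there (there (there (here refl)))

other-letter : (p q r : Fin 2) → p ≢ q → r ≢ p → r ≡ q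
other-letter zero       zero       _          p≢q _   = ⊥-elim (p≢q refl)
other-letter zero       (suc zero) zero       _   r≢p = ⊥-elim (r≢p refl)
other-letter zero       (suc zero) (suc zero) _   _   = refl
other-letter (suc zero) zero       zero       _   _   = refl
other-letter (suc zero) zero       (suc zero) _   r≢p = ⊥-elim (r≢p refl)
other-letter (suc zero) (suc zero) _          p≢q _   = ⊥-elim (p≢q refl)

Sorts : ∀ {n} → Ordering n → Fin n → Fin n → Fin n → Set
Sorts φ u v t = (φ ⟨$⟩ʳ u Fin.< φ ⟨$⟩ʳ v) × (φ ⟨$⟩ʳ v Fin.< φ ⟨$⟩ʳ t)

-- Take a position j
-- where u and t differ and put u's block first; v shares the block of u or of t,
-- and the direction is chosen to sort the two elements sharing a block.
testFamily-sorts : ∀ {n L} (label : Fin n → Fin L → Fin 2) → Separating label →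
  ∀ {u v t} → u ≢ v → v ≢ t → u ≢ t → ∃ λ φ → φ ∈ testFamily label × Sorts φ u v t
testFamily-sorts {n} label separating {u} {v} {t} u≢v v≢t u≢t with separating u≢t
... | j , u≢t-at-j = sorted (label v j ≟ β)
  where
  β : Fin 2
  β = label u j
  first : Fin n → Bool
  first x = does (label x j ≟ β)
  u-first : first u ≡ true
  u-first = dec-true (β ≟ β) refl
  t-second : first t ≡ false
  t-second = dec-false (label t j ≟ β) (λ eq → u≢t-at-j (sym eq))
  sorted : Dec (label v j ≡ β) → ∃ λ φ → φ ∈ testFamily label × Sorts φ u v t
  sorted (yes v~u) with d , lt ← orient u≢v =
    testOrdering label j β d , testOrdering∈testFamily label j β d ,
    blockOrdering-within first d (trans u-first (sym (dec-true (label v j ≟ β) v~u))) lt ,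
    blockOrdering-across first d (dec-true (label v j ≟ β) v~u) t-second
  sorted (no v≁u) with d , lt ← orient v≢t =
    testOrdering label j β d , testOrdering∈testFamily label j β d ,
    blockOrdering-across first d u-first (dec-false (label v j ≟ β) v≁u) ,
    blockOrdering-within first d v~t lt
    where
    v~t : first v ≡ first t
    v~t = cong (λ ℓ → does (ℓ ≟ β)) (other-letter β (label t j) (label v j) u≢t-at-j v≁u)

first-letter middle-letter last-letter : S3 → Fin 3
first-letter  w = proj₁ (letters w)
middle-letter w = proj₁ (proj₂ (letters w))
last-letter   w = proj₂ (proj₂ (letters w))

letters-distinct : ∀ w → first-letter w ≢ middle-letter w × middle-letter w ≢ last-letter w × first-letter w ≢ last-letter w
letters-distinct w123 = (λ ()) , (λ ()) , (λ ())
letters-distinct w132 = (λ ()) , (λ ()) , (λ ())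
letters-distinct w213 = (λ ()) , (λ ()) , (λ ())
letters-distinct w231 = (λ ()) , (λ ()) , (λ ())
letters-distinct w312 = (λ ()) , (λ ()) , (λ ())
letters-distinct w321 = (λ ()) , (λ ()) , (λ ())

ord-intro : ∀ {n} (φ : Ordering n) (x : Constraint n) w → let ξ = proj₁ x in
  Sorts φ (ξ (first-letter w)) (ξ (middle-letter w)) (ξ (last-letter w)) → Ord≡ φ x w
ord-intro φ x w123 sorts = sorts
ord-intro φ x w132 sorts = sorts
ord-intro φ x w213 sorts = sorts
ord-intro φ x w231 sorts = sorts
ord-intro φ x w312 sorts = sorts
ord-intro φ x w321 sorts = sorts

-- Upper bound, valid for every nonempty Π: with w ∈ Π, the test family of the
-- binary digits covers every constraint x, since it sorts the triple of x read
-- in the order given by w.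
upperBound : ∀ Π → NonEmpty Π → ∀ n → ∃ λ (Φ : List (Ordering n)) → Covers Π Φ × length Φ ≤ 4 * ⌈log₂ n ⌉
upperBound Π (w , w∈Π) n = testFamily label , covers , ≤-reflexive (testFamily-length label)
  where
  label : Fin n → Fin ⌈log₂ n ⌉ → Fin 2
  label = digits (n≤2^⌈log₂n⌉ n)
  covers : Covers Π (testFamily label)
  covers (ξ , ξ-injective) with d₁₂ , d₂₃ , d₁₃ ← letters-distinct w
    with φ , φ∈ , sorts ← testFamily-sorts label (digits-separating (n≤2^⌈log₂n⌉ n))
           (d₁₂ ∘′ ξ-injective) (d₂₃ ∘′ ξ-injective) (d₁₃ ∘′ ξ-injective)
    = φ , φ∈ , w , w∈Π , ord-intro φ (ξ , ξ-injective) w sorts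

Between : ∀ {n} → Ordering n → Fin n → Fin n → Fin n → Set
Between φ y a b = Sorts φ a y b ⊎ Sorts φ b y a

triple : ∀ {n} → Fin n → Fin n → Fin n → Fin 3 → Fin n
triple p q r zero             = p
triple p q r (suc zero)       = q
triple p q r (suc (suc zero)) = r

triple-injective : ∀ {n} {p q r : Fin n} → p ≢ q → q ≢ r → p ≢ r → Injective _≡_ _≡_ (triple p q r)
triple-injective p≢q q≢r p≢r {zero}             {zero}             _  = refl
triple-injective p≢q q≢r p≢r {zero}             {suc zero}         eq = ⊥-elim (p≢q eq)
triple-injective p≢q q≢r p≢r {zero}             {suc (suc zero)}   eq = ⊥-elim (p≢r eq)
triple-injective p≢q q≢r p≢r {suc zero}         {zero}             eq = ⊥-elim (p≢q (sym eq))
triple-injective p≢q q≢r p≢r {suc zero}         {suc zero}         _  = refl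
triple-injective p≢q q≢r p≢r {suc zero}         {suc (suc zero)}   eq = ⊥-elim (q≢r eq)
triple-injective p≢q q≢r p≢r {suc (suc zero)}   {zero}             eq = ⊥-elim (p≢r (sym eq))
triple-injective p≢q q≢r p≢r {suc (suc zero)}   {suc zero}         eq = ⊥-elim (q≢r (sym eq))
triple-injective p≢q q≢r p≢r {suc (suc zero)}   {suc (suc zero)}   _  = refl

placing : ∀ {n} → Fin 3 → (y a b : Fin n) → y ≢ a → y ≢ b → a ≢ b → Constraint n
placing zero             y a b y≢a y≢b a≢b = triple y a b , triple-injective y≢a a≢b y≢b
placing (suc zero)       y a b y≢a y≢b a≢b = triple a y b , triple-injective (y≢a ∘′ sym) y≢b a≢b
placing (suc (suc zero)) y a b y≢a y≢b a≢b = triple a b y , triple-injective a≢b (y≢b ∘′ sym) (y≢a ∘′ sym)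

-- Every word of M_i has the letter i in the middle, so if ord(φ, x) ∈ M_i for the
-- constraint x placing y at position i, then φ puts y between the two others.
M⇒between : ∀ {n} (φ : Ordering n) i {y a b} (y≢a : y ≢ a) (y≢b : y ≢ b) (a≢b : a ≢ b) w →
  M i w → Ord≡ φ (placing i y a b y≢a y≢b a≢b) w → Between φ y a b
M⇒between φ zero             _ _ _ .w213 (inj₁ refl) ord = inj₁ ord
M⇒between φ zero             _ _ _ .w312 (inj₂ refl) ord = inj₂ ord
M⇒between φ (suc zero)       _ _ _ .w123 (inj₁ refl) ord = inj₁ ord
M⇒between φ (suc zero)       _ _ _ .w321 (inj₂ refl) ord = inj₂ ord
M⇒between φ (suc (suc zero)) _ _ _ .w132 (inj₁ refl) ord = inj₁ ord
M⇒between φ (suc (suc zero)) _ _ _ .w231 (inj₂ refl) ord = inj₂ ord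

-- M_1, M_2, M_3 partition S_3; hence a Π meeting only M_i is contained in M_i.
classOf : S3 → Fin 3
classOf w213 = zero
classOf w312 = zero
classOf w123 = suc zero
classOf w321 = suc zero
classOf w132 = suc (suc zero)
classOf w231 = suc (suc zero)

∈classOf : ∀ w → M (classOf w) w
∈classOf w213 = inj₁ refl
∈classOf w312 = inj₂ refl
∈classOf w123 = inj₁ refl
∈classOf w321 = inj₂ refl
∈classOf w132 = inj₁ refl
∈classOf w231 = inj₂ refl

⊆onlyClass : ∀ {Π} (exactlyOne : MeetsExactlyOne Π) {w} → w ∈Π Π → M (proj₁ exactlyOne) w
⊆onlyClass (i , _ , only-i) {w} w∈Π =
  subst (λ j → M j w) (only-i (classOf w) (w , ∈classOf w , w∈Π)) (∈classOf w)

Separates : ∀ {n} → List (Ordering n) → Fin n → Set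
Separates Φ y = ∀ {a b} → y ≢ a → y ≢ b → a ≢ b → ∃ λ φ → φ ∈ Φ × Between φ y a b

-- If Π ⊆ M_i, a Π-covering family is separated by every element: cover the
-- constraint placing y at position i.
covering⇒separates : ∀ {n Π} {Φ : List (Ordering n)} → MeetsExactlyOne Π → Covers Π Φ → ∀ y → Separates Φ y
covering⇒separates exactlyOne covers y y≢a y≢b a≢b
  with φ , φ∈Φ , w , w∈Π , ord ← covers (placing (proj₁ exactlyOne) y _ _ y≢a y≢b a≢b)
  = φ , φ∈Φ , M⇒between φ (proj₁ exactlyOne) y≢a y≢b a≢b w (⊆onlyClass exactlyOne w∈Π) ord

first-not-between : ∀ {n} (φ : Ordering (suc n)) {y a b} → φ ⟨$⟩ʳ y ≡ zero → ¬ Between φ y a b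
first-not-between φ {y} {a} {b} y-first (inj₁ (a<y , _)) = n≮0 (subst (λ z → toℕ (φ ⟨$⟩ʳ a) < toℕ z) y-first a<y)
first-not-between φ {y} {a} {b} y-first (inj₂ (b<y , _)) = n≮0 (subst (λ z → toℕ (φ ⟨$⟩ʳ b) < toℕ z) y-first b<y)

separates-tail : ∀ {n} (φ : Ordering (suc n)) {Ψ y} → φ ⟨$⟩ʳ y ≡ zero → Separates (φ ∷ Ψ) y → Separates Ψ y
separates-tail φ y-first separates y≢a y≢b a≢b with separates y≢a y≢b a≢b
... | _ , here refl  , btw = ⊥-elim (first-not-between φ y-first btw)
... | ψ , there ψ∈Ψ , btw = ψ , ψ∈Ψ , btw

side : ∀ {n} → Ordering n → Fin n → Fin n → Fin 2
side φ y a = if does (φ ⟨$⟩ʳ y Fin.<? φ ⟨$⟩ʳ a) then suc zero else zero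

side-after : ∀ {n} (φ : Ordering n) {y a} → φ ⟨$⟩ʳ y Fin.< φ ⟨$⟩ʳ a → side φ y a ≡ suc zero
side-after φ {y} {a} y<a rewrite dec-true (φ ⟨$⟩ʳ y Fin.<? φ ⟨$⟩ʳ a) y<a = refl

side-before : ∀ {n} (φ : Ordering n) {y a} → φ ⟨$⟩ʳ a Fin.< φ ⟨$⟩ʳ y → side φ y a ≡ zero
side-before φ {y} {a} a<y rewrite dec-false (φ ⟨$⟩ʳ y Fin.<? φ ⟨$⟩ʳ a) (<-asym a<y) = refl

between⇒sides-differ : ∀ {n} (φ : Ordering n) {y a b} → Between φ y a b → side φ y a ≢ side φ y b
between⇒sides-differ φ (inj₁ (a<y , y<b)) eq with () ← trans (sym (side-before φ a<y)) (trans eq (side-after φ y<b))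
between⇒sides-differ φ (inj₂ (b<y , y<a)) eq with () ← trans (sym (side-after φ y<a)) (trans eq (side-before φ b<y))

-- Lower bound mechanism: if y separates Ψ, the sides of the other n - 1 elements
-- relative to y in the orderings of Ψ form a separating binary labelling.
separates⇒≤ : ∀ {m} (Ψ : List (Ordering (suc m))) y → Separates Ψ y → m ≤ 2 ^ length Ψ
separates⇒≤ {m} Ψ y separates = separating⇒≤ signature signature-separating
  where
  signature : Fin m → Fin (length Ψ) → Fin 2
  signature a j = side (lookup Ψ j) y (punchIn y a)
  signature-separating : Separating signature
  signature-separating {a} {b} a≢b
    with φ , φ∈Ψ , btw ← separates (punchInᵢ≢i y a ∘′ sym) (punchInᵢ≢i y b ∘′ sym) (a≢b ∘′ punchIn-injective y a b)
    = index φ∈Ψ , between⇒sides-differ (lookup Ψ (index φ∈Ψ)) (subst (λ ψ → Between ψ y _ _) (lookup-index φ∈Ψ) btw)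

-- Lower bound: a nonempty Π-covering family φ ∷ Ψ is separated by the first
-- element y of φ, so n - 1 ≤ 2 ^ |Ψ|.  A covering family is nonempty once n ≥ 3.
lowerBound : ∀ Π → MeetsExactlyOne Π → ∀ n → 3 ≤ n →
  (Φ : List (Ordering n)) → Covers Π Φ → 2 * (n ∸ 1) ≤ 2 ^ length Φ
lowerBound Π exactlyOne _ (s≤s (s≤s (s≤s _))) [] covers
  with _ , () , _ ← covers (triple zero (suc zero) (suc (suc zero)) , triple-injective (λ ()) (λ ()) (λ ()))
lowerBound Π exactlyOne (suc m) _ (φ ∷ Ψ) covers =
  *-monoʳ-≤ 2 (separates⇒≤ Ψ y (separates-tail φ (inverseʳ φ) (covering⇒separates exactlyOne covers y)))
  where
  y : Fin (suc m)
  y = φ ⟨$⟩ˡ zero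

lemma4p7 : (Π : SubS3) → NonEmpty Π → MeetsExactlyOne Π → (n : ℕ) → 3 ≤ n →
    ((Φ : List (Ordering n)) → Covers Π Φ → 2 * (n ∸ 1) ≤ 2 ^ length Φ)
    × (∃ λ (Φ : List (Ordering n)) → Covers Π Φ × length Φ ≤ 4 * ⌈log₂ n ⌉)
lemma4p7 Π nonempty exactlyOne n n≥3 = lowerBound Π exactlyOne n n≥3 , upperBound Π nonempty n
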